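{- Let $P$ be a finite poset with a minimum element $\hat{0}$, let $m$ be a positive integer such that $\mathcal{L}_m(P)\neq\emptyset$, and suppose $P$ has a branch with $k$ elements, where $1\le k\le m-2$. Consider the action of $\partial_K$ on $\mathcal{L}_m(P)$. (a) $m-1$ divides the order $o(\partial_K)$ of $\partial_K$ as a permutation of $\mathcal{L}_m(P)$. (b) If $\gcd(k,m-1)=1$, then $m-1$ divides the size of every orbit of $\partial_K$ on $\mathcal{L}_m(P)$.
   Context: For a positive integer $m$, $[m]=\{1,\dots,m\}$. An $m$-packed labeling of a finite poset $P$ is a surjection $L:P\to[m]$ such that $x<_P y$ implies $L(x)<L(y)$; $\mathcal{L}_m(P)$ is the set of all of them. $K$-promotion $\partial_K:\mathcal{L}_m(P)\to\mathcal{L}_m(P)$ is defined as follows. Given $L$, erase the labels of all elements labeled $1$. Then for $i=2,3,\dots,m$ in turn: for every cover relation $x\lessdot y$ such that $x$ is currently unlabeled and $y$ currently has label $i$, give $x$ the label $i$ and erase the label of $y$ (all such pairs processed simultaneously; other elements unchanged). Finally decrease every existing label by $1$ and give label $m$ to every unlabeled element. This is a bijection of $\mathcal{L}_m(P)$; its orbits are the orbits of the cyclic group it generates. The principal subposets of $P$ are the connected components (in the Hasse diagram) of $P-\{\hat 0\}$; a branch is a principal subposet which is a chain. -}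

module Defs where

open import Level using (0ℓ)
open import Data.Nat using (ℕ; zero; suc; _≤_; _<_; _∸_; _≟_)
open import Data.Fin using (Fin)
open import Data.Fin.Properties using (any?; all?)
open import Data.Maybe using (Maybe; just; nothing)
open import Data.Maybe.Properties using (≡-dec)
open import Data.Bool using (Bool; true; false; if_then_else_; _∧_)
open import Data.Product using (Σ; ∃; _×_; _,_)
open import Data.Sum using (_⊎_)
open import Data.List using (List; length)
open import Data.List.Membership.Propositional using (_∈_)
open import Data.List.Relation.Unary.Unique.Propositional using (Unique)
open import Function using (_∘_)
open import Relation.Nullary using (¬_; Dec; yes; no)
open import Relation.Nullary.Decidable using (⌊_⌋; _×-dec_; ¬?)
open import Relation.Binary using (Rel; IsDecPartialOrder; Decidable)
open import Relation.Binary.PropositionalEquality using (_≡_; _≢_; _≗_)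
open import Relation.Binary.Construct.Closure.ReflexiveTransitive using (Star)

record FinPoset (n : ℕ) : Set₁ where
  field
    _≼_ : Rel (Fin n) 0ℓ
    isDecPartialOrder : IsDecPartialOrder _≡_ _≼_
  open IsDecPartialOrder isDecPartialOrder public
    using (_≤?_) renaming (_≟_ to _≟P_)

  _≺_ : Rel (Fin n) 0ℓ
  x ≺ y = (x ≼ y) × (x ≢ y)

  _≺?_ : Decidable _≺_
  x ≺? y = (x ≤? y) ×-dec ¬? (x ≟P y)

  _⋖_ : Rel (Fin n) 0ℓ
  x ⋖ y = (x ≺ y) × (∀ z → ¬ ((x ≺ z) × (z ≺ y)))

  _⋖?_ : Decidable _⋖_
  x ⋖? y = (x ≺? y) ×-dec all? (λ z → ¬? ((x ≺? z) ×-dec (z ≺? y)))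

open FinPoset public

-- Labelings are functions P → ℕ (labels meant to lie in [m] = {1,…,m}).
Labeling : ℕ → Set
Labeling n = Fin n → ℕ

IsPacked : ∀ {n} → FinPoset n → ℕ → Labeling n → Set
IsPacked P m L =
  (∀ x → 1 ≤ L x × L x ≤ m) ×
  (∀ j → 1 ≤ j → j ≤ m → ∃ λ x → L x ≡ j) ×
  (∀ x y → _≺_ P x y → L x < L y)

-- One sliding step of K-promotion at label i (all cover pairs x ⋖ y with
-- x unlabeled and y labeled i processed simultaneously).
slideStep : ∀ {n} → FinPoset n → ℕ → (Fin n → Maybe ℕ) → (Fin n → Maybe ℕ)
slideStep P i S x with S x
... | nothing =
  if ⌊ any? (λ y → _⋖?_ P x y ×-dec ≡-dec _≟_ (S y) (just i)) ⌋ then just i else nothing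
... | just j =
  if ⌊ j ≟ i ⌋ ∧ ⌊ any? (λ z → _⋖?_ P z x ×-dec ≡-dec _≟_ (S z) nothing) ⌋
  then nothing else just j

slides : ∀ {n} → FinPoset n → ℕ → ℕ → (Fin n → Maybe ℕ) → (Fin n → Maybe ℕ)
slides P i zero S = S
slides P i (suc k) S = slides P (suc i) k (slideStep P i S)

∂K : ∀ {n} → FinPoset n → ℕ → Labeling n → Labeling n
∂K P m L x with slides P 2 (m ∸ 1) start x
  where
    start : _ → Maybe ℕ
    start y = if ⌊ L y ≟ 1 ⌋ then nothing else just (L y)
... | just j = j ∸ 1
... | nothing = m

iterate : ∀ {A : Set} → (A → A) → ℕ → A → A
iterate f zero a = a
iterate f (suc t) a = f (iterate f t a)

IsOrderOfPromotion : ∀ {n} → FinPoset n → ℕ → ℕ → Set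
IsOrderOfPromotion P m t =
  1 ≤ t ×
  (∀ L → IsPacked P m L → iterate (∂K P m) t L ≗ L) ×
  (∀ s → 1 ≤ s → (∀ L → IsPacked P m L → iterate (∂K P m) s L ≗ L) → t ≤ s)

IsOrbitSize : ∀ {n} → FinPoset n → ℕ → Labeling n → ℕ → Set
IsOrbitSize P m L t =
  1 ≤ t ×
  iterate (∂K P m) t L ≗ L ×
  (∀ s → 1 ≤ s → iterate (∂K P m) s L ≗ L → t ≤ s)

IsMinimum : ∀ {n} → FinPoset n → Fin n → Set
IsMinimum P z = ∀ x → _≼_ P z x

HasseAdj : ∀ {n} → FinPoset n → Fin n → Rel (Fin n) 0ℓ
HasseAdj P z x y = x ≢ z × y ≢ z × (_⋖_ P x y ⊎ _⋖_ P y x)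

-- C (listed without repetition) is a branch of P with minimum ẑ:
-- a connected component of the Hasse diagram of P − {ẑ} which is a chain.
IsBranch : ∀ {n} → FinPoset n → Fin n → List (Fin n) → Set
IsBranch P z C =
  Unique C ×
  (∃ λ x → x ∈ C) ×
  (∀ x → x ∈ C → x ≢ z) ×
  (∀ x y → x ∈ C → y ∈ C → Star (HasseAdj P z) x y) ×
  (∀ x y → x ∈ C → HasseAdj P z x y → y ∈ C) ×
  (∀ x y → x ∈ C → y ∈ C → _≼_ P x y ⊎ _≼_ P y x)

-- K-promotion rotates the labels of a branch C.  After the first sliding round the minimum ẑ
-- carries label 2, which cuts C off from the rest of P; along the chain C the remaining labels
-- then simply slide down by one, and the element that held label 2 (if any) becomes the empty
-- element that finally receives label m.  Read modulo m - 1, the set of labels used on C is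
-- therefore rotated by one residue per step, so every s with ∂K^s L = L is a period of this
-- k-element subset of ℤ/(m - 1), and by Bézout so is gcd(s, m - 1).  If gcd(k, m - 1) = 1 the
-- subset splits into equally sized translates of a period, forcing the gcd to be m - 1.  For the
-- order of ∂K it suffices to exhibit one packed labeling whose branch occupies the top k labels:
-- a proper interval of ℤ/(m - 1) has no period other than multiples of m - 1.

module Submission where

open import Level using (0ℓ)
open import Defs using (FinPoset; module FinPoset; Labeling; IsPacked; IsMinimum; IsBranch; HasseAdj;
                        slideStep; slides; ∂K; iterate; IsOrderOfPromotion; IsOrbitSize)
open import Data.Nat
open import Data.Nat.Properties
open import Data.Nat.Divisibility using (_∣_; divides; ∣1⇒≡1; ∣⇒≤; ∣-trans; m≤n⇒m!∣n!; m∣m*n)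
open import Data.Nat.DivMod using (_%_; _/_; _mod_; m%n<n; m<n⇒m%n≡m; n%n≡0; [m+n]%n≡m%n; [m+kn]%n≡m%n; m≡m%n+[m/n]*n)
open import Data.Nat.GCD using (gcd; gcd-greatest; gcd[m,n]∣m; gcd[m,n]∣n; gcd[m,n]≢0; gcd-GCD; module Bézout)
open import Data.Fin using (Fin; toℕ; funToFin; finToFun)
open import Data.Fin.Properties using (all?; any?; pigeonhole; toℕ<n; finToFun-funToFin; toℕ-fromℕ<)
open import Data.Fin.Induction using (po-wellFounded; po-noetherian)
open import Data.Maybe using (Maybe; just; nothing)
open import Data.Maybe.Properties using (≡-dec; just-injective)
open import Data.Bool using (if_then_else_)
open import Data.Product using (∃; _×_; _,_; proj₁; proj₂)
open import Data.Sum using (_⊎_; inj₁; inj₂)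
open import Data.Empty using (⊥; ⊥-elim)
open import Data.List using (List; []; _∷_; length)
open import Data.List.Membership.Propositional using (_∈_; _∉_; find; lose)
import Data.List.Membership.DecPropositional as DecMembership
open import Data.List.Relation.Unary.Any using (here; there) renaming (any? to anyL?)
open import Data.List.Relation.Unary.All using () renaming (lookup to lookupAll)
open import Data.List.Relation.Unary.AllPairs using (_∷_)
open import Data.List.Relation.Unary.Unique.Propositional using (Unique)
open import Function using (_∘_; flip)
open import Function.Bundles using (_⇔_; mk⇔; Equivalence)
open import Function.Properties.Equivalence using (⇔-isEquivalence)
open import Induction.WellFounded using (Acc; acc)
open import Relation.Binary using (Rel; Setoid; IsEquivalence; IsDecPartialOrder; Poset; _Preserves_⟶_; _Respects_)
import Relation.Binary.Properties.Poset as PosetProperties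
open import Relation.Nullary using (Dec; yes; no; ¬_; map′)
open import Relation.Nullary.Decidable using (⌊_⌋; _×-dec_; _⊎-dec_; _→-dec_; ¬?)
open import Relation.Unary using (Pred; Decidable)
open import Relation.Binary.PropositionalEquality

module ⇔ = IsEquivalence (⇔-isEquivalence {ℓ = 0ℓ})

count : {Q : Pred ℕ 0ℓ} → Decidable Q → ℕ → ℕ
count Q? zero = 0
count Q? (suc N) with Q? N
... | yes _ = suc (count Q? N)
... | no _ = count Q? N

count-pos : ∀ {Q : Pred ℕ 0ℓ} (Q? : Decidable Q) {N r} → r < N → Q r → 1 ≤ count Q? N
count-pos Q? {suc N} {r} r<N q with Q? N
... | yes _ = s≤s z≤n
... | no ¬q with m<1+n⇒m<n∨m≡n r<N
...   | inj₁ r<N' = count-pos Q? r<N' q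
...   | inj₂ refl = ⊥-elim (¬q q)

module _ {Q : Pred ℕ 0ℓ} (Q? : Decidable Q) where

  count-+ : ∀ a b → count Q? (a + b) ≡ count Q? a + count (λ r → Q? (a + r)) b
  count-+ a zero = trans (cong (count Q?) (+-identityʳ a)) (sym (+-identityʳ _))
  count-+ a (suc b) rewrite +-suc a b with Q? (a + b)
  ... | yes _ = trans (cong suc (count-+ a b)) (sym (+-suc _ _))
  ... | no _ = count-+ a b

  count-< : ∀ {a b} → a < b → Q a → count Q? a < count Q? b
  count-< {a} {b} a<b q = begin-strict
      count Q? a                                     <⟨ m<m+n _ shifted-pos ⟩
      count Q? a + count (λ r → Q? (a + r)) (b ∸ a)  ≡⟨ count-+ a (b ∸ a) ⟨
      count Q? (a + (b ∸ a))                         ≡⟨ cong (count Q?) (m+[n∸m]≡n (<⇒≤ a<b)) ⟩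
      count Q? b                                     ∎
    where
    open ≤-Reasoning
    shifted-pos : 1 ≤ count (λ r → Q? (a + r)) (b ∸ a)
    shifted-pos = count-pos (λ r → Q? (a + r)) (m<n⇒0<n∸m a<b) (subst Q (sym (+-identityʳ a)) q)

  count-witness : ∀ N j → j < count Q? N → ∃ λ v → v < N × Q v × count Q? v ≡ j
  count-witness (suc N) j j<c with Q? N
  ... | no _ = let v , v<N , q , e = count-witness N j j<c in v , m<n⇒m<1+n v<N , q , e
  ... | yes q with j <? count Q? N
  ...   | yes j<c' = let v , v<N , q' , e = count-witness N j j<c' in v , m<n⇒m<1+n v<N , q' , e
  ...   | no j≮c' = N , ≤-refl , q , ≤-antisym (≮⇒≥ j≮c') (s≤s⁻¹ j<c)

  count-≤-∸ : ∀ {a} → (∀ r → Q r → a ≤ r) → ∀ N → count Q? N ≤ N ∸ a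
  count-≤-∸ above zero = z≤n
  count-≤-∸ {a} above (suc N) with Q? N
  ... | no _ = ≤-trans (count-≤-∸ above N) (∸-monoˡ-≤ a (n≤1+n N))
  ... | yes q = ≤-trans (s≤s (count-≤-∸ above N)) (≤-reflexive (sym (+-∸-assoc 1 (above N q))))

module _ {Q R : Pred ℕ 0ℓ} (Q? : Decidable Q) (R? : Decidable R) where

  count-cong : ∀ N → (∀ r → r < N → Q r ⇔ R r) → count Q? N ≡ count R? N
  count-cong zero h = refl
  count-cong (suc N) h with Q? N | R? N
  ... | yes _ | yes _ = cong suc (count-cong N (λ r r<N → h r (m<n⇒m<1+n r<N)))
  ... | yes q | no ¬r = ⊥-elim (¬r (Equivalence.to (h N ≤-refl) q))
  ... | no ¬q | yes r = ⊥-elim (¬q (Equivalence.from (h N ≤-refl) r))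
  ... | no _ | no _ = count-cong N (λ r r<N → h r (m<n⇒m<1+n r<N))

  count-mono : ∀ N → (∀ r → r < N → Q r → R r) → count Q? N ≤ count R? N
  count-mono zero h = z≤n
  count-mono (suc N) h with Q? N | R? N
  ... | yes _ | yes _ = s≤s (count-mono N (λ r r<N → h r (m<n⇒m<1+n r<N)))
  ... | yes q | no ¬r = ⊥-elim (¬r (h N ≤-refl q))
  ... | no _ | yes _ = m≤n⇒m≤1+n (count-mono N (λ r r<N → h r (m<n⇒m<1+n r<N)))
  ... | no _ | no _ = count-mono N (λ r r<N → h r (m<n⇒m<1+n r<N))

  count-⊎ : ∀ N → (∀ r → Q r → R r → ⊥) → count (λ r → Q? r ⊎-dec R? r) N ≡ count Q? N + count R? N
  count-⊎ zero h = refl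
  count-⊎ (suc N) h with Q? N | R? N
  ... | yes q | yes r = ⊥-elim (h N q r)
  ... | yes _ | no _ = cong suc (count-⊎ N h)
  ... | no _ | yes _ = trans (cong suc (count-⊎ N h)) (sym (+-suc _ _))
  ... | no _ | no _ = count-⊎ N h

  count-⊎-≤ : ∀ N → count (λ r → Q? r ⊎-dec R? r) N ≤ count Q? N + count R? N
  count-⊎-≤ zero = z≤n
  count-⊎-≤ (suc N) with Q? N | R? N
  ... | yes _ | yes _ = s≤s (≤-trans (count-⊎-≤ N) (≤-trans (m≤n+m _ 1) (≤-reflexive (sym (+-suc _ _)))))
  ... | yes _ | no _ = s≤s (count-⊎-≤ N)
  ... | no _ | yes _ = ≤-trans (s≤s (count-⊎-≤ N)) (≤-reflexive (sym (+-suc _ _)))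
  ... | no _ | no _ = count-⊎-≤ N

count-≥ : ∀ a N → count (a ≤?_) N ≡ N ∸ a
count-≥ a zero = sym (0∸n≡0 a)
count-≥ a (suc N) with a ≤? N
... | yes a≤N = trans (cong suc (count-≥ a N)) (sym (+-∸-assoc 1 a≤N))
... | no a≰N = trans (count-≥ a N) (trans (m≤n⇒m∸n≡0 (≤-trans (n≤1+n N) (≰⇒> a≰N))) (sym (m≤n⇒m∸n≡0 (≰⇒> a≰N))))

count-≟ : ∀ {a N} → a < N → count (a ≟_) N ≡ 1
count-≟ {a} {suc N} a<N with a ≟ N
... | yes refl = cong suc (below N ≤-refl)
  where
  below : ∀ M → M ≤ a → count (a ≟_) M ≡ 0
  below zero _ = refl
  below (suc M) sM≤a with a ≟ M
  ... | yes refl = ⊥-elim (<-irrefl refl sM≤a)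
  ... | no _ = below M (<⇒≤ sM≤a)
... | no a≢N with m<1+n⇒m<n∨m≡n a<N
...   | inj₁ a<N' = count-≟ a<N'
...   | inj₂ a≡N = ⊥-elim (a≢N a≡N)

module _ {A : Set} (h : A → ℕ) where

  Image : List A → Pred ℕ 0ℓ
  Image C r = ∃ λ y → y ∈ C × h y ≡ r

  image? : ∀ C → Decidable (Image C)
  image? C r with anyL? (λ y → h y ≟ r) C
  ... | yes a = yes (find a)
  ... | no ¬a = no λ (y , y∈C , e) → ¬a (lose y∈C e)

  count-image : ∀ N (C : List A) → Unique C → (∀ {x y} → x ∈ C → y ∈ C → h x ≡ h y → x ≡ y) →
                (∀ {y} → y ∈ C → h y < N) → count (image? C) N ≡ length C
  count-image N [] _ _ _ = none N
    where
    none : ∀ M → count (image? []) M ≡ 0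
    none zero = refl
    none (suc M) with image? [] M
    ... | yes (_ , () , _)
    ... | no _ = none M
  count-image N (c ∷ C) (c∉C ∷ uniq) inj bound = begin
      count (image? (c ∷ C)) N                         ≡⟨ count-cong (image? (c ∷ C)) (λ r → (h c ≟ r) ⊎-dec image? C r) N (λ r _ → mk⇔ split join) ⟩
      count (λ r → (h c ≟ r) ⊎-dec image? C r) N       ≡⟨ count-⊎ (h c ≟_) (image? C) N disjoint ⟩
      count (h c ≟_) N + count (image? C) N            ≡⟨ cong₂ _+_ (count-≟ (bound (here refl))) (count-image N C uniq (λ x y → inj (there x) (there y)) (bound ∘ there)) ⟩
      suc (length C)                                   ∎
    where
    open ≡-Reasoning
    split : ∀ {r} → Image (c ∷ C) r → h c ≡ r ⊎ Image C r
    split (_ , here refl , e) = inj₁ e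
    split (y , there y∈C , e) = inj₂ (y , y∈C , e)
    join : ∀ {r} → h c ≡ r ⊎ Image C r → Image (c ∷ C) r
    join (inj₁ e) = c , here refl , e
    join (inj₂ (y , y∈C , e)) = y , there y∈C , e
    disjoint : ∀ r → h c ≡ r → Image C r → ⊥
    disjoint r e (y , y∈C , e') = lookupAll c∉C y∈C (inj (here refl) (there y∈C) (trans e (sym e')))

Periodic : Pred ℕ 0ℓ → ℕ → Set
Periodic f s = ∀ r → f r ⇔ f (r + s)

module _ {f : Pred ℕ 0ℓ} where

  periodic-* : ∀ {s} → Periodic f s → ∀ q → Periodic f (q * s)
  periodic-* {s} per zero r = subst (λ u → f r ⇔ f u) (sym (+-identityʳ r)) ⇔.refl
  periodic-* {s} per (suc q) r = ⇔.trans (periodic-* per q r)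
    (subst (λ u → f (r + q * s) ⇔ f u) (trans (+-assoc r (q * s) s) (cong (r +_) (+-comm (q * s) s))) (per (r + q * s)))

  periodic-gcd : ∀ {s M} → Periodic f s → Periodic f M → Periodic f (gcd s M)
  periodic-gcd {s} {M} per-s per-M r with Bézout.identity (gcd-GCD s M)
  ... | Bézout.+- x y eq = ⇔.trans (periodic-* per-s x r)
          (⇔.sym (subst (λ u → f (r + gcd s M) ⇔ f u) rearrange (periodic-* per-M y (r + gcd s M))))
    where
    rearrange : r + gcd s M + y * M ≡ r + x * s
    rearrange = trans (+-assoc r _ _) (cong (r +_) eq)
  ... | Bézout.-+ x y eq = ⇔.trans (periodic-* per-M y r)
          (⇔.sym (subst (λ u → f (r + gcd s M) ⇔ f u) rearrange (periodic-* per-s x (r + gcd s M))))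
    where
    rearrange : r + gcd s M + x * s ≡ r + y * M
    rearrange = trans (+-assoc r _ _) (cong (r +_) eq)

  count-periodic : ∀ (f? : Decidable f) {g} → Periodic f g → ∀ q → count f? (q * g) ≡ q * count f? g
  count-periodic f? {g} per zero = refl
  count-periodic f? {g} per (suc q) = begin
      count f? (g + q * g)                              ≡⟨ count-+ f? g (q * g) ⟩
      count f? g + count (λ r → f? (g + r)) (q * g)      ≡⟨ cong (count f? g +_) (count-cong _ f? (q * g) (λ r _ → ⇔.sym (subst (λ u → f r ⇔ f u) (+-comm r g) (per r)))) ⟩
      count f? g + count f? (q * g)                     ≡⟨ cong (count f? g +_) (count-periodic f? per q) ⟩
      count f? g + q * count f? g                       ∎
    where open ≡-Reasoning

  -- The point M ∸ k ∸ g (or 0, when g > M ∸ k) lies below the interval and its shift by g inside it.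
  interval-period-≥ : ∀ {M k g} → 1 ≤ k → k < M → (∀ r → r < M → f r ⇔ M ∸ k ≤ r) →
                      Periodic f g → 1 ≤ g → M ≤ g
  interval-period-≥ {M} {k} {g} 1≤k k<M interval per 1≤g with M ≤? g
  ... | yes M≤g = M≤g
  ... | no M≰g with g ≤? M ∸ k
  ...   | yes g≤b = ⊥-elim (<-irrefl refl (begin-strict
            M ∸ k            ≤⟨ Equivalence.to (interval (M ∸ k ∸ g) (≤-<-trans (m∸n≤m _ g) b<M))
                                  (Equivalence.from (per (M ∸ k ∸ g)) (subst f (sym (m∸n+n≡m g≤b)) f-b)) ⟩
            M ∸ k ∸ g        <⟨ ∸-monoʳ-< 1≤g g≤b ⟩
            M ∸ k ∸ 0        ≡⟨⟩
            M ∸ k            ∎))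
    where
    open ≤-Reasoning
    b<M : M ∸ k < M
    b<M = ∸-monoʳ-< 1≤k (<⇒≤ k<M)
    f-b : f (M ∸ k)
    f-b = Equivalence.from (interval (M ∸ k) b<M) ≤-refl
  ...   | no g≰b = ⊥-elim (<-irrefl refl (<-≤-trans (m<n⇒0<n∸m k<M) (Equivalence.to (interval 0 (≤-<-trans z≤n g<M))
            (Equivalence.from (per 0) (Equivalence.from (interval g g<M) (<⇒≤ (≰⇒> g≰b)))))))
    where
    g<M : g < M
    g<M = ≰⇒> M≰g

  interval-invariant⇒∣ : ∀ {M k s} → 1 ≤ k → k < M → (∀ r → r < M → f r ⇔ M ∸ k ≤ r) →
                         Periodic f M → Periodic f s → M ∣ s
  interval-invariant⇒∣ {M} {k} {s} 1≤k k<M interval per-M per-s =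
    subst (_∣ s) (≤-antisym g≤M M≤g) (gcd[m,n]∣m s M)
    where
    instance _ = >-nonZero (≤-<-trans z≤n k<M)
    g≤M : gcd s M ≤ M
    g≤M = ∣⇒≤ (gcd[m,n]∣n s M)
    M≤g : M ≤ gcd s M
    M≤g = interval-period-≥ 1≤k k<M interval (periodic-gcd per-s per-M)
            (n≢0⇒n>0 (gcd[m,n]≢0 s M (inj₂ (≢-nonZero⁻¹ M))))

  coprime-count-invariant⇒∣ : ∀ (f? : Decidable f) {M k s} → count f? M ≡ k → gcd k M ≡ 1 →
                              Periodic f M → Periodic f s → M ∣ s
  coprime-count-invariant⇒∣ f? {M} {k} {s} count≡k coprime per-M per-s with gcd[m,n]∣n s M
  ... | divides q M≡q*g = subst (_∣ s) (sym M≡g) (gcd[m,n]∣m s M)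
    where
    g : ℕ
    g = gcd s M
    k≡q*c : k ≡ q * count f? g
    k≡q*c = trans (sym count≡k) (trans (cong (count f?) M≡q*g) (count-periodic f? (periodic-gcd per-s per-M) q))
    q≡1 : q ≡ 1
    q≡1 = ∣1⇒≡1 (subst (q ∣_) coprime (gcd-greatest (divides (count f? g) (trans k≡q*c (*-comm q _)))
                                                     (divides g (trans M≡q*g (*-comm q g)))))
    M≡g : M ≡ g
    M≡g = trans M≡q*g (trans (cong (_* g) q≡1) (+-identityʳ g))

least : ∀ {Q : Pred ℕ 0ℓ} → Decidable Q → ∀ {p} → Q p → ∃ λ t → Q t × ∀ s → Q s → t ≤ s
least {Q} Q? {p} q = search p 0 (λ _ ()) q
  where
  search : ∀ d b → (∀ s → s < b → ¬ Q s) → Q (b + d) → ∃ λ t → Q t × ∀ s → Q s → t ≤ s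
  search d b below q with Q? b
  ... | yes qb = b , qb , λ s qs → ≮⇒≥ (λ s<b → below s s<b qs)
  search zero b below q | no ¬qb = ⊥-elim (¬qb (subst Q (+-identityʳ b) q))
  search (suc d) b below q | no ¬qb = search d (suc b) below' (subst Q (+-suc b d) q)
    where
    below' : ∀ s → s < suc b → ¬ Q s
    below' s s<sb with m<1+n⇒m<n∨m≡n s<sb
    ... | inj₁ s<b = below s s<b
    ... | inj₂ refl = ¬qb

iterate-+ : ∀ {A : Set} (f : A → A) a b x → iterate f (a + b) x ≡ iterate f a (iterate f b x)
iterate-+ f zero b x = refl
iterate-+ f (suc a) b x = cong f (iterate-+ f a b x)

module FiniteDynamics
  {X : Set} {_≈_ : Rel X 0ℓ} (≈-isEquivalence : IsEquivalence _≈_) (_≈?_ : ∀ x y → Dec (x ≈ y))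
  {Ok : Pred X 0ℓ} (Ok? : Decidable Ok) (Ok-resp-≈ : Ok Respects _≈_)
  {f : X → X} (f-cong : f Preserves _≈_ ⟶ _≈_) (f-ok : ∀ {x} → Ok x → Ok (f x))
  (f-injective : ∀ {x y} → Ok x → Ok y → f x ≈ f y → x ≈ y)
  {N : ℕ} (code : X → Fin N) (decode : Fin N → X) (decode-code : ∀ {x} → Ok x → decode (code x) ≈ x)
  where

  module ≈ = IsEquivalence ≈-isEquivalence

  iterate-ok : ∀ s {x} → Ok x → Ok (iterate f s x)
  iterate-ok zero ok = ok
  iterate-ok (suc s) ok = f-ok (iterate-ok s ok)

  iterate-cong : ∀ s {x y} → x ≈ y → iterate f s x ≈ iterate f s y
  iterate-cong zero e = e
  iterate-cong (suc s) e = f-cong (iterate-cong s e)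

  iterate-cancel : ∀ a d {x} → Ok x → iterate f a x ≈ iterate f (a + d) x → x ≈ iterate f d x
  iterate-cancel zero d ok e = e
  iterate-cancel (suc a) d ok e = iterate-cancel a d ok (f-injective (iterate-ok a ok) (iterate-ok (a + d) ok) e)

  iterate-* : ∀ q d {x} → iterate f d x ≈ x → iterate f (q * d) x ≈ x
  iterate-* zero d e = ≈.refl
  iterate-* (suc q) d {x} e = ≈.trans (≈.reflexive (iterate-+ f d (q * d) x)) (≈.trans (iterate-cong d (iterate-* q d e)) e)

  -- Two of the first N + 1 iterates have the same code; injectivity cancels the common prefix.
  period-≤ : ∀ {x} → Ok x → ∃ λ d → 1 ≤ d × d ≤ N × iterate f d x ≈ x
  period-≤ {x} ok with pigeonhole (n<1+n N) (λ i → code (iterate f (toℕ i) x))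
  ... | i , j , i<j , same-code = toℕ j ∸ toℕ i , m<n⇒0<n∸m i<j , d≤N , ≈.sym (iterate-cancel (toℕ i) _ ok xi≈xj)
    where
    d≤N : toℕ j ∸ toℕ i ≤ N
    d≤N = ≤-trans (m∸n≤m (toℕ j) (toℕ i)) (s≤s⁻¹ (toℕ<n j))
    xi≈xj : iterate f (toℕ i) x ≈ iterate f (toℕ i + (toℕ j ∸ toℕ i)) x
    xi≈xj = ≈.trans (≈.sym (decode-code (iterate-ok (toℕ i) ok)))
            (≈.trans (≈.reflexive (cong decode same-code))
            (≈.trans (decode-code (iterate-ok (toℕ j) ok))
                     (≈.reflexive (cong (λ t → iterate f t x) (sym (m+[n∸m]≡n (<⇒≤ i<j)))))))

  period-! : ∀ {x} → Ok x → iterate f (N !) x ≈ x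
  period-! ok with period-≤ ok
  ... | suc d , _ , d≤N , e with ∣-trans (m∣m*n (d !)) (m≤n⇒m!∣n! d≤N)
  ...   | divides q N!≡q*d = ≈.trans (≈.reflexive (cong (λ t → iterate f t _) N!≡q*d)) (iterate-* q (suc d) e)

  orbitSize : ∀ {x} → Ok x → ∃ λ t → 1 ≤ t × iterate f t x ≈ x × (∀ s → 1 ≤ s → iterate f s x ≈ x → t ≤ s)
  orbitSize {x} ok with least (λ s → (1 ≤? s) ×-dec (iterate f s x ≈? x)) (1≤n! N , period-! ok)
  ... | t , (1≤t , e) , minimal = t , 1≤t , e , λ s 1≤s e' → minimal s (1≤s , e')

  PeriodOfAll : ℕ → Set
  PeriodOfAll s = ∀ x → Ok x → iterate f s x ≈ x

  -- Periodicity of all points is decidable because it suffices to test the N decoded codes.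
  order : ∃ λ t → 1 ≤ t × PeriodOfAll t × (∀ s → 1 ≤ s → PeriodOfAll s → t ≤ s)
  order with least (λ s → (1 ≤? s) ×-dec all? (λ c → Ok? (decode c) →-dec (iterate f s (decode c) ≈? decode c)))
                   (1≤n! N , λ c ok → period-! ok)
  ... | t , (1≤t , on-codes) , minimal = t , 1≤t , all-points , λ s 1≤s per → minimal s (1≤s , λ c ok → per (decode c) ok)
    where
    all-points : PeriodOfAll t
    all-points x ok = ≈.trans (iterate-cong t (≈.sym dc)) (≈.trans (on-codes (code x) (Ok-resp-≈ (≈.sym dc) ok)) dc)
      where
      dc : decode (code x) ≈ x
      dc = decode-code ok

if-yes : ∀ {A B : Set} (d : Dec A) {a b : B} → A → (if ⌊ d ⌋ then a else b) ≡ a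
if-yes (yes _) _ = refl
if-yes (no ¬p) p = ⊥-elim (¬p p)

if-no : ∀ {A B : Set} (d : Dec A) {a b : B} → ¬ A → (if ⌊ d ⌋ then a else b) ≡ b
if-no (yes p) ¬p = ⊥-elim (¬p p)
if-no (no _) _ = refl

module PosetFacts {n} (P : FinPoset n) where
  open FinPoset P public using (_≼_; _≺_; _⋖_; _≺?_; _⋖?_)
  module ≼ = IsDecPartialOrder (FinPoset.isDecPartialOrder P)

  private
    ≼-poset : Poset _ _ _
    ≼-poset = record { isPartialOrder = ≼.isPartialOrder }

  open PosetProperties ≼-poset public using () renaming (<-irrefl to ≺-irrefl)

  ≺-≼-trans : ∀ {x y z} → x ≺ y → y ≼ z → x ≺ z
  ≺-≼-trans (x≼y , x≢y) y≼z = ≼.trans x≼y y≼z , λ { refl → x≢y (≼.antisym x≼y y≼z) }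

  between : ∀ {x y} → x ≺ y → ¬ x ⋖ y → ∃ λ u → x ≺ u × u ≺ y
  between {x} {y} x≺y ¬x⋖y with any? (λ u → (x ≺? u) ×-dec (u ≺? y))
  ... | yes found = found
  ... | no none = ⊥-elim (¬x⋖y (x≺y , λ u p → none (u , p)))

  cover-below : ∀ {x y} → x ≺ y → ∃ λ v → x ≼ v × v ⋖ y
  cover-below {x} {y} = go (po-noetherian ≼.isPartialOrder x) ≼.refl
    where
    go : ∀ {w} → Acc (flip _≺_) w → x ≼ w → w ≺ y → ∃ λ v → x ≼ v × v ⋖ y
    go {w} (acc rec) x≼w w≺y with w ⋖? y
    ... | yes w⋖y = w , x≼w , w⋖y
    ... | no ¬w⋖y with between w≺y ¬w⋖y
    ...   | u , w≺u , u≺y = go (rec w≺u) (≼.trans x≼w (proj₁ w≺u)) u≺y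

  cover-above : ∀ {x y} → x ≺ y → ∃ λ v → x ⋖ v × v ≼ y
  cover-above {x} {y} = go (po-wellFounded ≼.isPartialOrder y) ≼.refl
    where
    go : ∀ {w} → Acc _≺_ w → w ≼ y → x ≺ w → ∃ λ v → x ⋖ v × v ≼ y
    go {w} (acc rec) w≼y x≺w with x ⋖? w
    ... | yes x⋖w = w , x⋖w , w≼y
    ... | no ¬x⋖w with between x≺w ¬x⋖w
    ...   | u , x≺u , u≺w = go (rec u≺w) (≼.trans (proj₁ u≺w) w≼y) x≺u

-- States of K-promotion: a partial labeling, nothing meaning unlabeled.
State : ℕ → Set
State n = Fin n → Maybe ℕ

module Sliding {n} (P : FinPoset n) where
  open PosetFacts P

  UpperCoverLabeled : ℕ → State n → Fin n → Set
  UpperCoverLabeled i S x = ∃ λ y → x ⋖ y × S y ≡ just i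

  LowerCoverEmpty : State n → Fin n → Set
  LowerCoverEmpty S x = ∃ λ w → w ⋖ x × S w ≡ nothing

  upperCoverLabeled? : ∀ i S x → Dec (UpperCoverLabeled i S x)
  upperCoverLabeled? i S x = any? (λ y → (x ⋖? y) ×-dec ≡-dec _≟_ (S y) (just i))

  lowerCoverEmpty? : ∀ S x → Dec (LowerCoverEmpty S x)
  lowerCoverEmpty? S x = any? (λ w → (w ⋖? x) ×-dec ≡-dec _≟_ (S w) nothing)

  slideStep-fill : ∀ i S x → S x ≡ nothing → UpperCoverLabeled i S x → slideStep P i S x ≡ just i
  slideStep-fill i S x Sx≡ u rewrite Sx≡ = if-yes (upperCoverLabeled? i S x) u

  slideStep-empty : ∀ i S x → S x ≡ nothing → ¬ UpperCoverLabeled i S x → slideStep P i S x ≡ nothing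
  slideStep-empty i S x Sx≡ ¬u rewrite Sx≡ = if-no (upperCoverLabeled? i S x) ¬u

  slideStep-other : ∀ i S x {j} → S x ≡ just j → j ≢ i → slideStep P i S x ≡ just j
  slideStep-other i S x {j} Sx≡ j≢i rewrite Sx≡ with j ≟ i
  ... | yes j≡i = ⊥-elim (j≢i j≡i)
  ... | no _ = refl

  slideStep-vacate : ∀ i S x → S x ≡ just i → LowerCoverEmpty S x → slideStep P i S x ≡ nothing
  slideStep-vacate i S x Sx≡ l rewrite Sx≡ with i ≟ i
  ... | no i≢i = ⊥-elim (i≢i refl)
  ... | yes _ = if-yes (lowerCoverEmpty? S x) l

  slideStep-stay : ∀ i S x → S x ≡ just i → ¬ LowerCoverEmpty S x → slideStep P i S x ≡ just i
  slideStep-stay i S x Sx≡ ¬l rewrite Sx≡ with i ≟ i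
  ... | no i≢i = ⊥-elim (i≢i refl)
  ... | yes _ = if-no (lowerCoverEmpty? S x) ¬l

  data SlideView (i : ℕ) (S : State n) (x : Fin n) : Maybe ℕ → Set where
    filled  : S x ≡ nothing → UpperCoverLabeled i S x → SlideView i S x (just i)
    empty   : S x ≡ nothing → ¬ UpperCoverLabeled i S x → SlideView i S x nothing
    other   : ∀ j → S x ≡ just j → j ≢ i → SlideView i S x (just j)
    vacated : S x ≡ just i → LowerCoverEmpty S x → SlideView i S x nothing
    stayed  : S x ≡ just i → ¬ LowerCoverEmpty S x → SlideView i S x (just i)

  slideView : ∀ i S x {v} → slideStep P i S x ≡ v → SlideView i S x v
  slideView i S x refl = view (S x) refl
    where
    view : ∀ v → S x ≡ v → SlideView i S x (slideStep P i S x)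
    view nothing Sx≡ with upperCoverLabeled? i S x
    ... | yes u = subst (SlideView i S x) (sym (slideStep-fill i S x Sx≡ u)) (filled Sx≡ u)
    ... | no ¬u = subst (SlideView i S x) (sym (slideStep-empty i S x Sx≡ ¬u)) (empty Sx≡ ¬u)
    view (just j) Sx≡ with j ≟ i
    ... | no j≢i = subst (SlideView i S x) (sym (slideStep-other i S x Sx≡ j≢i)) (other j Sx≡ j≢i)
    ... | yes refl with lowerCoverEmpty? S x
    ...   | yes l = subst (SlideView i S x) (sym (slideStep-vacate i S x Sx≡ l)) (vacated Sx≡ l)
    ...   | no ¬l = subst (SlideView i S x) (sym (slideStep-stay i S x Sx≡ ¬l)) (stayed Sx≡ ¬l)

  inspectSlide : ∀ i S x → ∃ λ v → slideStep P i S x ≡ v × SlideView i S x v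
  inspectSlide i S x = _ , refl , slideView i S x refl

  slideStep-cong : ∀ i {S S'} → S ≗ S' → slideStep P i S ≗ slideStep P i S'
  slideStep-cong i {S} {S'} S≗S' x with inspectSlide i S x
  ... | _ , e , filled Sx (y , c , Sy) = trans e (sym (slideStep-fill i S' x (trans (sym (S≗S' x)) Sx) (y , c , trans (sym (S≗S' y)) Sy)))
  ... | _ , e , empty Sx ¬u = trans e (sym (slideStep-empty i S' x (trans (sym (S≗S' x)) Sx) λ (y , c , S'y) → ¬u (y , c , trans (S≗S' y) S'y)))
  ... | _ , e , other j Sx j≢i = trans e (sym (slideStep-other i S' x (trans (sym (S≗S' x)) Sx) j≢i))
  ... | _ , e , vacated Sx (w , c , Sw) = trans e (sym (slideStep-vacate i S' x (trans (sym (S≗S' x)) Sx) (w , c , trans (sym (S≗S' w)) Sw)))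
  ... | _ , e , stayed Sx ¬l = trans e (sym (slideStep-stay i S' x (trans (sym (S≗S' x)) Sx) λ (w , c , S'w) → ¬l (w , c , trans (S≗S' w) S'w)))

  slides-cong : ∀ k i {S S'} → S ≗ S' → slides P i k S ≗ slides P i k S'
  slides-cong zero i S≗S' = S≗S'
  slides-cong (suc k) i S≗S' = slides-cong k (suc i) (slideStep-cong i S≗S')

  slideStep-keeps-label : ∀ i S v → (∃ λ x → S x ≡ just v) → ∃ λ x → slideStep P i S x ≡ just v
  slideStep-keeps-label i S v (x , Sx) with v ≟ i
  ... | no v≢i = x , slideStep-other i S x Sx v≢i
  ... | yes refl with lowerCoverEmpty? S x
  ...   | yes (w , c , Sw) = w , slideStep-fill i S w Sw (x , c , Sx)
  ...   | no ¬l = x , slideStep-stay i S x Sx ¬l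

  slides-keep-label : ∀ k i S v → (∃ λ x → S x ≡ just v) → ∃ λ x → slides P i k S x ≡ just v
  slides-keep-label zero i S v found = found
  slides-keep-label (suc k) i S v found = slides-keep-label k (suc i) _ v (slideStep-keeps-label i S v found)

  slideStep-keeps-empty : ∀ i S → (∃ λ x → S x ≡ nothing) → ∃ λ x → slideStep P i S x ≡ nothing
  slideStep-keeps-empty i S (x , Sx) with upperCoverLabeled? i S x
  ... | yes (y , c , Sy) = y , slideStep-vacate i S y Sy (x , c , Sx)
  ... | no ¬u = x , slideStep-empty i S x Sx ¬u

  slides-keep-empty : ∀ k i S → (∃ λ x → S x ≡ nothing) → ∃ λ x → slides P i k S x ≡ nothing
  slides-keep-empty zero i S found = found
  slides-keep-empty (suc k) i S found = slides-keep-empty k (suc i) _ (slideStep-keeps-empty i S found)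

  -- The invariant of a state just before the labels i are slid down.
  record Valid (m i : ℕ) (S : State n) : Set where
    field
      empty-incomparable : ∀ {x y} → S x ≡ nothing → S y ≡ nothing → ¬ x ≺ y
      labels-increase    : ∀ {x y a b} → S x ≡ just a → S y ≡ just b → x ≺ y → a < b
      above-empty-≥      : ∀ {x y b} → S x ≡ nothing → S y ≡ just b → x ≺ y → i ≤ b
      below-empty-<      : ∀ {x y a} → S x ≡ just a → S y ≡ nothing → x ≺ y → a < i
      label-range        : ∀ {x a} → S x ≡ just a → 2 ≤ a × a ≤ m
  open Valid

  module _ {m i : ℕ} {S : State n} (V : Valid m i S) where

    empty-below-is-cover : ∀ {x y} → S x ≡ nothing → S y ≡ just i → x ≺ y → x ⋖ y
    empty-below-is-cover {x} {y} Sx Sy x≺y with cover-below x≺y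
    ... | w , x≼w , w⋖y with x Data.Fin.≟ w
    ...   | yes refl = w⋖y
    ...   | no x≢w with S w in Sw
    ...     | nothing = ⊥-elim (empty-incomparable V Sx Sw (x≼w , x≢w))
    ...     | just a = ⊥-elim (<-irrefl refl (≤-<-trans (above-empty-≥ V Sx Sw (x≼w , x≢w)) (labels-increase V Sw Sy (proj₁ w⋖y))))

    slideStep-valid : 2 ≤ i → i ≤ m → Valid m (suc i) (slideStep P i S)
    empty-incomparable (slideStep-valid _ _) {x} {y} Tx Ty x≺y with slideView i S x Tx | slideView i S y Ty
    ... | empty Sx _ | empty Sy _ = empty-incomparable V Sx Sy x≺y
    ... | empty Sx ¬u | vacated Sy _ = ¬u (y , empty-below-is-cover Sx Sy x≺y , Sy)
    ... | vacated Sx _ | empty Sy _ = <-irrefl refl (below-empty-< V Sx Sy x≺y)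
    ... | vacated Sx _ | vacated Sy _ = <-irrefl refl (labels-increase V Sx Sy x≺y)
    labels-increase (slideStep-valid _ _) {x} {y} Tx Ty x≺y with slideView i S x Tx | slideView i S y Ty
    ... | filled Sx _ | filled Sy _ = ⊥-elim (empty-incomparable V Sx Sy x≺y)
    ... | filled Sx _ | other b Sy b≢i = ≤∧≢⇒< (above-empty-≥ V Sx Sy x≺y) (λ i≡b → b≢i (sym i≡b))
    ... | filled Sx _ | stayed Sy ¬l = ⊥-elim (¬l (x , empty-below-is-cover Sx Sy x≺y , Sx))
    ... | other a Sx _ | filled Sy _ = below-empty-< V Sx Sy x≺y
    ... | other a Sx _ | other b Sy _ = labels-increase V Sx Sy x≺y
    ... | other a Sx _ | stayed Sy _ = labels-increase V Sx Sy x≺y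
    ... | stayed Sx _ | filled Sy _ = below-empty-< V Sx Sy x≺y
    ... | stayed Sx _ | other b Sy _ = labels-increase V Sx Sy x≺y
    ... | stayed Sx _ | stayed Sy _ = labels-increase V Sx Sy x≺y
    above-empty-≥ (slideStep-valid _ _) {x} {y} Tx Ty x≺y with slideView i S x Tx | slideView i S y Ty
    ... | empty Sx _ | filled Sy _ = ⊥-elim (empty-incomparable V Sx Sy x≺y)
    ... | empty Sx _ | other b Sy b≢i = ≤∧≢⇒< (above-empty-≥ V Sx Sy x≺y) (λ i≡b → b≢i (sym i≡b))
    ... | empty Sx _ | stayed Sy ¬l = ⊥-elim (¬l (x , empty-below-is-cover Sx Sy x≺y , Sx))
    ... | vacated Sx _ | filled Sy _ = ⊥-elim (<-irrefl refl (below-empty-< V Sx Sy x≺y))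
    ... | vacated Sx _ | other b Sy _ = labels-increase V Sx Sy x≺y
    ... | vacated Sx _ | stayed Sy _ = ⊥-elim (<-irrefl refl (labels-increase V Sx Sy x≺y))
    below-empty-< (slideStep-valid _ _) {x} {y} Tx Ty x≺y with slideView i S x Tx | slideView i S y Ty
    ... | filled _ _ | _ = n<1+n i
    ... | stayed _ _ | _ = n<1+n i
    ... | other a Sx _ | empty Sy _ = m≤n⇒m≤1+n (below-empty-< V Sx Sy x≺y)
    ... | other a Sx _ | vacated Sy _ = m≤n⇒m≤1+n (labels-increase V Sx Sy x≺y)
    label-range (slideStep-valid 2≤i i≤m) {x} Tx with slideView i S x Tx
    ... | filled _ _ = 2≤i , i≤m
    ... | other a Sx _ = label-range V Sx
    ... | stayed Sx _ = label-range V Sx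

  slides-valid : ∀ {m} k i {S} → Valid m i S → 2 ≤ i → i + k ≤ suc m → Valid m (i + k) (slides P i k S)
  slides-valid zero i {S} V _ _ = subst (λ j → Valid _ j S) (sym (+-identityʳ i)) V
  slides-valid (suc k) i V 2≤i bound rewrite +-suc i k =
    slides-valid k (suc i) (slideStep-valid V 2≤i (s≤s⁻¹ (≤-trans (s≤s (m≤m+n i k)) bound))) (m≤n⇒m≤1+n 2≤i) bound

  private
    nothing≢just : ∀ {a : ℕ} → ¬ (nothing ≡ just a)
    nothing≢just ()

  -- Only an element filled from an upper cover labeled i could be empty before and labeled after,
  -- and that upper cover would then violate validity of the other state.
  slideStep-empty≢labeled : ∀ {m i S S'} → Valid m i S → Valid m i S' → slideStep P i S ≗ slideStep P i S' →
                            ∀ {x b} → S x ≡ nothing → S' x ≡ just b → ⊥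
  slideStep-empty≢labeled {i = i} {S} {S'} V V' same {x} Sx S'x with inspectSlide i S x
  ... | _ , e , filled _ (y , c , Sy) with slideView i S' x (trans (sym (same x)) e)
  ...   | filled S'x' _ = nothing≢just (trans (sym S'x') S'x)
  ...   | other _ _ j≢i = j≢i refl
  ...   | stayed S'x' _ with slideView i S' y (trans (sym (same y)) (slideStep-vacate i S y Sy (x , c , Sx)))
  ...     | empty S'y _ = <-irrefl refl (below-empty-< V' S'x' S'y (proj₁ c))
  ...     | vacated S'y _ = <-irrefl refl (labels-increase V' S'x' S'y (proj₁ c))
  slideStep-empty≢labeled {i = i} {S} {S'} V V' same {x} Sx S'x | _ , e , empty _ _ with slideView i S' x (trans (sym (same x)) e)
  ...   | empty S'x' _ = nothing≢just (trans (sym S'x') S'x)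
  ...   | vacated S'x' (w , c , S'w) with slideView i S w (trans (same w) (slideStep-fill i S' w S'w (x , c , S'x')))
  ...     | filled Sw _ = empty-incomparable V Sw Sx (proj₁ c)
  ...     | other _ _ j≢i = j≢i refl
  ...     | stayed Sw _ = <-irrefl refl (below-empty-< V Sw Sx (proj₁ c))
  slideStep-empty≢labeled V V' same Sx S'x | _ , _ , other _ Sx' _ = nothing≢just (trans (sym Sx) Sx')
  slideStep-empty≢labeled V V' same Sx S'x | _ , _ , vacated Sx' _ = nothing≢just (trans (sym Sx) Sx')
  slideStep-empty≢labeled V V' same Sx S'x | _ , _ , stayed Sx' _ = nothing≢just (trans (sym Sx) Sx')

  slideStep-other-label : ∀ {i S S'} → slideStep P i S ≗ slideStep P i S' →
                          ∀ {x a b} → S x ≡ just a → a ≢ i → S' x ≡ just b → a ≡ b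
  slideStep-other-label {i} {S} {S'} same {x} Sx a≢i S'x with slideView i S' x (trans (sym (same x)) (slideStep-other i S x Sx a≢i))
  ... | filled S'x' _ = ⊥-elim (nothing≢just (trans (sym S'x') S'x))
  ... | other _ S'x' _ = just-injective (trans (sym S'x') S'x)
  ... | stayed _ _ = ⊥-elim (a≢i refl)

  slideStep-injective : ∀ {m i S S'} → Valid m i S → Valid m i S' → slideStep P i S ≗ slideStep P i S' → S ≗ S'
  slideStep-injective {i = i} {S} {S'} V V' same x with S x in Sx | S' x in S'x
  ... | nothing | nothing = refl
  ... | nothing | just b = ⊥-elim (slideStep-empty≢labeled {S = S} {S'} V V' same Sx S'x)
  ... | just a | nothing = ⊥-elim (slideStep-empty≢labeled {S = S'} {S} V' V (sym ∘ same) S'x Sx)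
  ... | just a | just b with a ≟ i | b ≟ i
  ...   | no a≢i | _ = cong just (slideStep-other-label {S = S} {S'} same Sx a≢i S'x)
  ...   | yes _ | no b≢i = cong just (sym (slideStep-other-label {S = S'} {S} (sym ∘ same) S'x b≢i Sx))
  ...   | yes refl | yes refl = refl

  slides-injective : ∀ {m} k i {S S'} → Valid m i S → Valid m i S' → 2 ≤ i → i + k ≤ suc m →
                     slides P i k S ≗ slides P i k S' → S ≗ S'
  slides-injective zero i V V' _ _ same = same
  slides-injective (suc k) i V V' 2≤i bound same rewrite +-suc i k =
    slideStep-injective V V' (slides-injective k (suc i) (slideStep-valid V 2≤i i≤m) (slideStep-valid V' 2≤i i≤m)
                                (m≤n⇒m≤1+n 2≤i) bound same)
    where
    i≤m : i ≤ _
    i≤m = s≤s⁻¹ (≤-trans (s≤s (m≤m+n i k)) bound)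

erase1 : ∀ {n} → Labeling n → State n
erase1 L y = if ⌊ L y ≟ 1 ⌋ then nothing else just (L y)

finish : ℕ → Maybe ℕ → ℕ
finish m (just j) = j ∸ 1
finish m nothing = m

erase1-1 : ∀ {n} (L : Labeling n) {y} → L y ≡ 1 → erase1 L y ≡ nothing
erase1-1 L {y} = if-yes (L y ≟ 1)

erase1-≢1 : ∀ {n} (L : Labeling n) {y} → L y ≢ 1 → erase1 L y ≡ just (L y)
erase1-≢1 L {y} = if-no (L y ≟ 1)

erase1-nothing : ∀ {n} (L : Labeling n) {y} → erase1 L y ≡ nothing → L y ≡ 1
erase1-nothing L {y} e with L y ≟ 1
... | yes Ly≡1 = Ly≡1
... | no _ with () ← e

erase1-just : ∀ {n} (L : Labeling n) {y a} → erase1 L y ≡ just a → L y ≡ a × a ≢ 1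
erase1-just L {y} e with L y ≟ 1
... | yes _ with () ← e
erase1-just L refl | no Ly≢1 = refl , Ly≢1

module Promotion {n} (P : FinPoset n) (m : ℕ) where
  open PosetFacts P
  open Sliding P
  open Valid

  Packed : Labeling n → Set
  Packed = IsPacked P m

  packed? : ∀ L → Dec (Packed L)
  packed? L = all? (λ x → (1 ≤? L x) ×-dec (L x ≤? m))
          ×-dec map′ (λ h j 1≤j j≤m → h (s≤s j≤m) 1≤j) (λ h {j} j<1+m 1≤j → h j 1≤j (s≤s⁻¹ j<1+m))
                     (allUpTo? (λ j → (1 ≤? j) →-dec any? (λ x → L x ≟ j)) (suc m))
          ×-dec all? (λ x → all? (λ y → (x ≺? y) →-dec (L x <? L y)))

  packed-resp-≗ : ∀ {L L'} → L ≗ L' → Packed L → Packed L'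
  packed-resp-≗ L≗L' (bounds , onto , strict) =
    (λ x → subst (λ v → 1 ≤ v × v ≤ m) (L≗L' x) (bounds x)) ,
    (λ j 1≤j j≤m → let x , Lx≡j = onto j 1≤j j≤m in x , trans (sym (L≗L' x)) Lx≡j) ,
    (λ x y x≺y → subst₂ _<_ (L≗L' x) (L≗L' y) (strict x y x≺y))

  erase1-valid : ∀ {L} → Packed L → Valid m 2 (erase1 L)
  empty-incomparable (erase1-valid {L} (_ , _ , strict)) {x} {y} Ex Ey x≺y =
    <-irrefl refl (subst₂ _<_ (erase1-nothing L Ex) (erase1-nothing L Ey) (strict x y x≺y))
  labels-increase (erase1-valid {L} (_ , _ , strict)) {x} {y} Ex Ey x≺y =
    subst₂ _<_ (proj₁ (erase1-just L Ex)) (proj₁ (erase1-just L Ey)) (strict x y x≺y)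
  above-empty-≥ (erase1-valid {L} (bounds , _ , _)) {y = y} _ Ey _ with erase1-just L Ey
  ... | refl , Ly≢1 = ≤∧≢⇒< (proj₁ (bounds y)) (λ 1≡Ly → Ly≢1 (sym 1≡Ly))
  below-empty-< (erase1-valid {L} (bounds , _ , strict)) {x} {y} _ Ey x≺y =
    ⊥-elim (<-irrefl refl (≤-<-trans (proj₁ (bounds x)) (subst (L x <_) (erase1-nothing L Ey) (strict x y x≺y))))
  label-range (erase1-valid {L} (bounds , _ , _)) {x} Ex with erase1-just L Ex
  ... | refl , Lx≢1 = ≤∧≢⇒< (proj₁ (bounds x)) (λ 1≡Lx → Lx≢1 (sym 1≡Lx)) , proj₂ (bounds x)

  slid : Labeling n → State n
  slid L = slides P 2 (m ∸ 1) (erase1 L)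

  2+[m∸1]≡1+m : 1 ≤ m → 2 + (m ∸ 1) ≡ suc m
  2+[m∸1]≡1+m 1≤m = cong suc (m+[n∸m]≡n 1≤m)

  slid-valid : 1 ≤ m → ∀ {L} → Packed L → Valid m (suc m) (slid L)
  slid-valid 1≤m {L} pk = subst (λ j → Valid m j (slid L)) (2+[m∸1]≡1+m 1≤m)
    (slides-valid (m ∸ 1) 2 (erase1-valid pk) ≤-refl (≤-reflexive (2+[m∸1]≡1+m 1≤m)))

  ∂K-slid : ∀ L x → ∂K P m L x ≡ finish m (slid L x)
  ∂K-slid L x with slid L x
  ... | just j = refl
  ... | nothing = refl

  module _ (1≤m : 1 ≤ m) {L : Labeling n} (pk : Packed L) where
    private
      V : Valid m (suc m) (slid L)
      V = slid-valid 1≤m pk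
      1≤a : ∀ {x a} → slid L x ≡ just a → 1 ≤ a
      1≤a e = ≤-trans (s≤s z≤n) (proj₁ (label-range V e))

    ∂K-bounded : ∀ x → 1 ≤ ∂K P m L x × ∂K P m L x ≤ m
    ∂K-bounded x rewrite ∂K-slid L x with slid L x in e
    ... | nothing = 1≤m , ≤-refl
    ... | just j = ∸-monoˡ-≤ 1 (proj₁ (label-range V e)) , ≤-trans (m∸n≤m j 1) (proj₂ (label-range V e))

    -- Label 1 leaves an empty element behind, and every other label j + 1 survives the slides.
    ∂K-onto : ∀ j → 1 ≤ j → j ≤ m → ∃ λ x → ∂K P m L x ≡ j
    ∂K-onto j 1≤j j≤m with j ≟ m | proj₁ (proj₂ pk)
    ... | yes refl | onto with onto 1 ≤-refl 1≤m
    ...   | x₁ , Lx₁≡1 with slides-keep-empty (m ∸ 1) 2 (erase1 L) (x₁ , erase1-1 L Lx₁≡1)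
    ...     | x , e = x , trans (∂K-slid L x) (cong (finish m) e)
    ∂K-onto j 1≤j j≤m | no j≢m | onto with onto (suc j) (s≤s z≤n) (≤∧≢⇒< j≤m j≢m)
    ...   | x₀ , Lx₀≡1+j with slides-keep-label (m ∸ 1) 2 (erase1 L) (suc j) (x₀ , trans (erase1-≢1 L Lx₀≢1) (cong just Lx₀≡1+j))
      where
      Lx₀≢1 : L x₀ ≢ 1
      Lx₀≢1 Lx₀≡1 = <-irrefl (sym (suc-injective (trans (sym Lx₀≡1+j) Lx₀≡1))) 1≤j
    ...     | x , e = x , trans (∂K-slid L x) (cong (finish m) e)

    ∂K-strict : ∀ x y → x ≺ y → ∂K P m L x < ∂K P m L y
    ∂K-strict x y x≺y rewrite ∂K-slid L x | ∂K-slid L y with slid L x in ex | slid L y in ey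
    ... | nothing | nothing = ⊥-elim (empty-incomparable V ex ey x≺y)
    ... | nothing | just b = ⊥-elim (<-irrefl refl (<-≤-trans (above-empty-≥ V ex ey x≺y) (proj₂ (label-range V ey))))
    ... | just a | nothing = ∸-monoˡ-< (below-empty-< V ex ey x≺y) (1≤a ex)
    ... | just a | just b = ∸-monoˡ-< (labels-increase V ex ey x≺y) (1≤a ex)

  ∂K-packed : 1 ≤ m → ∀ {L} → Packed L → Packed (∂K P m L)
  ∂K-packed 1≤m pk = ∂K-bounded 1≤m pk , ∂K-onto 1≤m pk , ∂K-strict 1≤m pk

  ∂K-cong : ∀ {L L'} → L ≗ L' → ∂K P m L ≗ ∂K P m L'
  ∂K-cong {L} {L'} L≗L' x = begin
      ∂K P m L x                    ≡⟨ ∂K-slid L x ⟩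
      finish m (slid L x)           ≡⟨ cong (finish m) (slides-cong (m ∸ 1) 2 (λ y → cong (λ v → if ⌊ v ≟ 1 ⌋ then nothing else just v) (L≗L' y)) x) ⟩
      finish m (slid L' x)          ≡⟨ ∂K-slid L' x ⟨
      ∂K P m L' x                   ∎
    where open ≡-Reasoning

  ∂K-injective : 1 ≤ m → ∀ {L L'} → Packed L → Packed L' → ∂K P m L ≗ ∂K P m L' → L ≗ L'
  ∂K-injective 1≤m {L} {L'} pk pk' same x =
    from-erase1 (slides-injective (m ∸ 1) 2 (erase1-valid pk) (erase1-valid pk') ≤-refl
                   (≤-reflexive (2+[m∸1]≡1+m 1≤m)) slid-same x)
    where
    V : Valid m (suc m) (slid L)
    V = slid-valid 1≤m pk
    V' : Valid m (suc m) (slid L')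
    V' = slid-valid 1≤m pk'
    ∸1<m : ∀ {a} → 2 ≤ a × a ≤ m → a ∸ 1 < m
    ∸1<m (2≤a , a≤m) = <-≤-trans (∸-monoˡ-< {n = 1} (n<1+n _) (≤-trans (s≤s z≤n) 2≤a)) a≤m
    slid-same : slid L ≗ slid L'
    slid-same y with trans (sym (∂K-slid L y)) (trans (same y) (∂K-slid L' y))
    ... | finish≡ with slid L y in ey | slid L' y in ey'
    ...   | nothing | nothing = refl
    ...   | nothing | just b = ⊥-elim (<-irrefl (sym finish≡) (∸1<m (label-range V' ey')))
    ...   | just a | nothing = ⊥-elim (<-irrefl finish≡ (∸1<m (label-range V ey)))
    ...   | just a | just b = cong just (∸-cancelʳ-≡ (≤-trans (s≤s z≤n) (proj₁ (label-range V ey)))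
                                                    (≤-trans (s≤s z≤n) (proj₁ (label-range V' ey'))) finish≡)
    from-erase1 : erase1 L x ≡ erase1 L' x → L x ≡ L' x
    from-erase1 e with erase1 L x in e₁ | erase1 L' x in e₂
    ... | nothing | nothing = trans (erase1-nothing L e₁) (sym (erase1-nothing L' e₂))
    ... | just a | just b = trans (proj₁ (erase1-just L e₁)) (trans (just-injective e) (sym (proj₁ (erase1-just L' e₂))))

  iterate-packed : 1 ≤ m → ∀ s {L} → Packed L → Packed (iterate (∂K P m) s L)
  iterate-packed 1≤m zero pk = pk
  iterate-packed 1≤m (suc s) pk = ∂K-packed 1≤m (iterate-packed 1≤m s pk)

module PromotionDynamics {n} (P : FinPoset n) (m-1 : ℕ) where
  open Promotion P (suc m-1)

  private
    m : ℕ
    m = suc m-1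

    encode : Labeling n → Fin (m ^ n)
    encode L = funToFin (λ x → (L x ∸ 1) mod m)

    decode : Fin (m ^ n) → Labeling n
    decode c x = suc (toℕ (finToFun c x))

    decode-encode : ∀ {L} → Packed L → decode (encode L) ≗ L
    decode-encode {L} (bounds , _ , _) x = begin
        suc (toℕ (finToFun (encode L) x))  ≡⟨ cong (suc ∘ toℕ) (finToFun-funToFin _ x) ⟩
        suc (toℕ ((L x ∸ 1) mod m))       ≡⟨ cong suc (toℕ-fromℕ< _) ⟩
        suc ((L x ∸ 1) % m)               ≡⟨ cong suc (m<n⇒m%n≡m (≤-trans (∸-monoˡ-< {n = 1} (n<1+n _) (proj₁ (bounds x))) (proj₂ (bounds x)))) ⟩
        suc (L x ∸ 1)                     ≡⟨ m+[n∸m]≡n (proj₁ (bounds x)) ⟩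
        L x                               ∎
      where
      open ≡-Reasoning

  open FiniteDynamics (Setoid.isEquivalence (Fin n →-setoid ℕ)) (λ L L' → all? (λ x → L x ≟ L' x)) packed? packed-resp-≗
         (∂K-cong) (∂K-packed (s≤s z≤n)) (∂K-injective (s≤s z≤n)) encode decode decode-encode
         public using (orbitSize; order)

module Branch {n} (P : FinPoset n) {z : Fin n} {C : List (Fin n)} (z-min : IsMinimum P z) (branch : IsBranch P z C) where
  open PosetFacts P
  open Sliding P

  branch-≢z : ∀ {y} → y ∈ C → y ≢ z
  branch-≢z {y} = proj₁ (proj₂ (proj₂ branch)) y

  private
    component : ∀ {x y} → x ∈ C → HasseAdj P z x y → y ∈ C
    component {x} {y} = proj₁ (proj₂ (proj₂ (proj₂ (proj₂ branch)))) x y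

  branch-unique : Unique C
  branch-unique = proj₁ branch

  branch-chain : ∀ {x y} → x ∈ C → y ∈ C → x ≼ y ⊎ y ≼ x
  branch-chain {x} {y} = proj₂ (proj₂ (proj₂ (proj₂ (proj₂ branch)))) x y

  z≺ : ∀ {x} → x ≢ z → z ≺ x
  z≺ {x} x≢z = z-min x , λ z≡x → x≢z (sym z≡x)

  branch-lower-cover : ∀ {y w} → y ∈ C → w ⋖ y → w ≢ z → w ∈ C
  branch-lower-cover y∈C w⋖y w≢z = component y∈C (branch-≢z y∈C , w≢z , inj₂ w⋖y)

  branch-upper-cover : ∀ {y w} → y ∈ C → y ⋖ w → w ∈ C
  branch-upper-cover {y} {w} y∈C y⋖w = component y∈C (branch-≢z y∈C , w≢z , inj₁ y⋖w)
    where
    w≢z : w ≢ z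
    w≢z refl = ≺-irrefl refl (≺-≼-trans (proj₁ y⋖w) (z-min y))

  branch-up-closed : ∀ {y q} → y ∈ C → y ≺ q → q ∈ C
  branch-up-closed {y} = go (po-noetherian ≼.isPartialOrder y)
    where
    go : ∀ {y q} → Acc (flip _≺_) y → y ∈ C → y ≺ q → q ∈ C
    go {y} {q} (acc rec) y∈C y≺q with cover-above y≺q
    ... | v , y⋖v , v≼q with v Data.Fin.≟ q
    ...   | yes refl = branch-upper-cover y∈C y⋖v
    ...   | no v≢q = go (rec (proj₁ y⋖v)) (branch-upper-cover y∈C y⋖v) (v≼q , v≢q)

  branch-down-closed : ∀ {q y} → q ≢ z → y ∈ C → q ≺ y → q ∈ C
  branch-down-closed {q} {y} q≢z = go (po-wellFounded ≼.isPartialOrder y)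
    where
    go : ∀ {y} → Acc _≺_ y → y ∈ C → q ≺ y → q ∈ C
    go (acc rec) y∈C q≺y with cover-below q≺y
    ... | w , q≼w , w⋖y with w Data.Fin.≟ z
    ...   | yes refl = ⊥-elim (q≢z (≼.antisym q≼w (z-min q)))
    ...   | no w≢z with q Data.Fin.≟ w
    ...     | yes refl = branch-lower-cover y∈C w⋖y w≢z
    ...     | no q≢w = go (rec (proj₁ w⋖y)) (branch-lower-cover y∈C w⋖y w≢z) (q≼w , q≢w)

  BranchLabel : Labeling n → Pred ℕ 0ℓ
  BranchLabel L = Image L C

  branchLabel? : ∀ L → Decidable (BranchLabel L)
  branchLabel? L = image? L C

  strict-injective-on-branch : ∀ {L : Labeling n} → (∀ x y → x ≺ y → L x < L y) →
                               ∀ {x y} → x ∈ C → y ∈ C → L x ≡ L y → x ≡ y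
  strict-injective-on-branch {L} strict {x} {y} x∈C y∈C Lx≡Ly with x Data.Fin.≟ y
  ... | yes x≡y = x≡y
  ... | no x≢y with branch-chain x∈C y∈C
  ...   | inj₁ x≼y = ⊥-elim (<-irrefl Lx≡Ly (strict x y (x≼y , x≢y)))
  ...   | inj₂ y≼x = ⊥-elim (<-irrefl (sym Lx≡Ly) (strict y x (y≼x , λ y≡x → x≢y (sym y≡x))))

  module Rotation (m-2 : ℕ) where
    m : ℕ
    m = suc (suc m-2)
    open Promotion P m
    open Valid

    module _ {L : Labeling n} (pk : Packed L) where
      private
        bounds : ∀ x → 1 ≤ L x × L x ≤ m
        bounds = proj₁ pk
        onto : ∀ j → 1 ≤ j → j ≤ m → ∃ λ x → L x ≡ j
        onto = proj₁ (proj₂ pk)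
        strict : ∀ x y → x ≺ y → L x < L y
        strict = proj₂ (proj₂ pk)

      L-min : L z ≡ 1
      L-min with onto 1 ≤-refl (s≤s z≤n)
      ... | x₁ , Lx₁≡1 with x₁ Data.Fin.≟ z
      ...   | yes refl = Lx₁≡1
      ...   | no x₁≢z = ⊥-elim (<-irrefl refl (≤-<-trans (proj₁ (bounds z)) (subst (L z <_) Lx₁≡1 (strict z x₁ (z≺ x₁≢z)))))

      L-≥2 : ∀ {x} → x ≢ z → 2 ≤ L x
      L-≥2 x≢z = subst (_< L _) L-min (strict z _ (z≺ x≢z))

      labeled-2-≢z : ∀ {w} → L w ≡ 2 → w ≢ z
      labeled-2-≢z Lw≡2 refl with trans (sym L-min) Lw≡2
      ... | ()

      labeled-2-covers-z : ∀ {w} → L w ≡ 2 → z ⋖ w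
      labeled-2-covers-z {w} Lw≡2 = z≺ (labeled-2-≢z Lw≡2) , λ u (z≺u , u≺w) →
        <-irrefl refl (≤-<-trans (L-≥2 (λ { refl → ≺-irrefl refl z≺u })) (subst (L u <_) Lw≡2 (strict u w u≺w)))

      private
        S₁ S₂ : State n
        S₁ = erase1 L
        S₂ = slideStep P 2 S₁

        S₁-≢z : ∀ {y} → y ≢ z → S₁ y ≡ just (L y)
        S₁-≢z y≢z = erase1-≢1 L (λ Ly≡1 → <-irrefl (sym Ly≡1) (L-≥2 y≢z))

        S₂-z : S₂ z ≡ just 2
        S₂-z with onto 2 (s≤s z≤n) (s≤s (s≤s z≤n))
        ... | w , Lw≡2 = slideStep-fill 2 S₁ z (erase1-1 L L-min)
                           (w , labeled-2-covers-z Lw≡2 , trans (S₁-≢z (labeled-2-≢z Lw≡2)) (cong just Lw≡2))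

        S₂-2 : ∀ {y} → y ≢ z → L y ≡ 2 → S₂ y ≡ nothing
        S₂-2 y≢z Ly≡2 = slideStep-vacate 2 S₁ _ (trans (S₁-≢z y≢z) (cong just Ly≡2)) (z , labeled-2-covers-z Ly≡2 , erase1-1 L L-min)

        S₂-≢2 : ∀ {y} → y ≢ z → L y ≢ 2 → S₂ y ≡ just (L y)
        S₂-≢2 y≢z Ly≢2 = slideStep-other 2 S₁ _ (S₁-≢z y≢z) Ly≢2

      record OnBranch (S : State n) : Set where
        field
          z-labeled-2   : S z ≡ just 2
          label-origin  : ∀ {v} → (∃ λ y → y ∈ C × S y ≡ just v) → BranchLabel L v × v ≢ 2
          label-kept    : ∀ {v} → BranchLabel L v → v ≢ 2 → ∃ λ y → y ∈ C × S y ≡ just v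
          empty-if-2    : BranchLabel L 2 → ∃ λ y → y ∈ C × S y ≡ nothing
          full-unless-2 : ¬ BranchLabel L 2 → ∀ {y} → y ∈ C → S y ≢ nothing
      open OnBranch

      private
        empty-≢z : ∀ {S} → OnBranch S → ∀ {w} → S w ≡ nothing → w ≢ z
        empty-≢z B Sw refl with trans (sym (z-labeled-2 B)) Sw
        ... | ()

      onBranch-step : ∀ i {S} → OnBranch S → i ≢ 2 → OnBranch (slideStep P i S)
      z-labeled-2 (onBranch-step i {S} B i≢2) = slideStep-other i S z (z-labeled-2 B) (λ 2≡i → i≢2 (sym 2≡i))
      label-origin (onBranch-step i {S} B i≢2) (y , y∈C , Ty) with slideView i S y Ty
      ... | filled Sy (w , c , Sw) = label-origin B (w , branch-upper-cover y∈C c , Sw)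
      ... | other v Sy _ = label-origin B (y , y∈C , Sy)
      ... | stayed Sy _ = label-origin B (y , y∈C , Sy)
      label-kept (onBranch-step i {S} B i≢2) {v} bl v≢2 with label-kept B bl v≢2
      ... | y , y∈C , Sy with v ≟ i
      ...   | no v≢i = y , y∈C , slideStep-other i S y Sy v≢i
      ...   | yes refl with lowerCoverEmpty? S y
      ...     | yes (w , c , Sw) = w , branch-lower-cover y∈C c (empty-≢z B Sw) , slideStep-fill v S w Sw (y , c , Sy)
      ...     | no ¬l = y , y∈C , slideStep-stay v S y Sy ¬l
      empty-if-2 (onBranch-step i {S} B i≢2) bl with empty-if-2 B bl
      ... | y , y∈C , Sy with upperCoverLabeled? i S y
      ...   | yes (w , c , Sw) = w , branch-upper-cover y∈C c , slideStep-vacate i S w Sw (y , c , Sy)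
      ...   | no ¬u = y , y∈C , slideStep-empty i S y Sy ¬u
      full-unless-2 (onBranch-step i {S} B i≢2) ¬bl {y} y∈C Ty with slideView i S y Ty
      ... | empty Sy _ = full-unless-2 B ¬bl y∈C Sy
      ... | vacated Sy (w , c , Sw) = full-unless-2 B ¬bl (branch-lower-cover y∈C c (empty-≢z B Sw)) Sw

      onBranch-slides : ∀ k i {S} → 3 ≤ i → OnBranch S → OnBranch (slides P i k S)
      onBranch-slides zero i _ B = B
      onBranch-slides (suc k) i 3≤i B =
        onBranch-slides k (suc i) (m≤n⇒m≤1+n 3≤i) (onBranch-step i B (λ { refl → <-irrefl refl 3≤i }))

      onBranch-S₂ : OnBranch S₂
      z-labeled-2 onBranch-S₂ = S₂-z
      label-origin onBranch-S₂ (y , y∈C , S₂y) with L y ≟ 2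
      ... | yes Ly≡2 with trans (sym (S₂-2 (branch-≢z y∈C) Ly≡2)) S₂y
      ...   | ()
      label-origin onBranch-S₂ (y , y∈C , S₂y) | no Ly≢2 = (y , y∈C , Ly≡v) , λ v≡2 → Ly≢2 (trans Ly≡v v≡2)
        where Ly≡v = just-injective (trans (sym (S₂-≢2 (branch-≢z y∈C) Ly≢2)) S₂y)
      label-kept onBranch-S₂ (y , y∈C , Ly≡v) v≢2 =
        y , y∈C , trans (S₂-≢2 (branch-≢z y∈C) (λ Ly≡2 → v≢2 (trans (sym Ly≡v) Ly≡2))) (cong just Ly≡v)
      empty-if-2 onBranch-S₂ (y , y∈C , Ly≡2) = y , y∈C , S₂-2 (branch-≢z y∈C) Ly≡2
      full-unless-2 onBranch-S₂ ¬bl {y} y∈C S₂y with L y ≟ 2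
      ... | yes Ly≡2 = ¬bl (y , y∈C , Ly≡2)
      ... | no Ly≢2 with trans (sym (S₂-≢2 (branch-≢z y∈C) Ly≢2)) S₂y
      ...   | ()

      private
        onBranch-slid : OnBranch (slid L)
        onBranch-slid = onBranch-slides m-2 3 ≤-refl onBranch-S₂

        V : Valid m (suc m) (slid L)
        V = slid-valid (s≤s z≤n) pk

        ∂K-branch : ∀ {y} → ∂K P m L y ≡ finish m (slid L y)
        ∂K-branch = ∂K-slid L _

      ∂K-branch-label : ∀ {v} → 2 ≤ v → v < m → BranchLabel (∂K P m L) v ⇔ BranchLabel L (suc v)
      ∂K-branch-label {v} 2≤v v<m = mk⇔ to from
        where
        to : BranchLabel (∂K P m L) v → BranchLabel L (suc v)
        to (y , y∈C , ∂Ly≡v) with slid L y in e | trans (sym ∂K-branch) ∂Ly≡v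
        ... | nothing | m≡v = ⊥-elim (<-irrefl (sym m≡v) v<m)
        ... | just j | j∸1≡v = subst (BranchLabel L) (trans (sym (m+[n∸m]≡n (≤-trans (s≤s z≤n) (proj₁ (label-range V e))))) (cong suc j∸1≡v))
                                  (proj₁ (label-origin onBranch-slid (y , y∈C , e)))
        from : BranchLabel L (suc v) → BranchLabel (∂K P m L) v
        from bl with label-kept onBranch-slid bl (λ { refl → <-irrefl refl 2≤v })
        ... | y , y∈C , e = y , y∈C , trans ∂K-branch (cong (finish m) e)

      ∂K-branch-label-m : BranchLabel (∂K P m L) m ⇔ BranchLabel L 2
      ∂K-branch-label-m = mk⇔ to from
        where
        to : BranchLabel (∂K P m L) m → BranchLabel L 2
        to (y , y∈C , ∂Ly≡m) with slid L y in e | trans (sym ∂K-branch) ∂Ly≡m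
        ... | nothing | _ with branchLabel? L 2
        ...   | yes bl = bl
        ...   | no ¬bl = ⊥-elim (full-unless-2 onBranch-slid ¬bl y∈C e)
        to (y , y∈C , ∂Ly≡m) | just j | j∸1≡m =
          ⊥-elim (<-irrefl j∸1≡m (<-≤-trans (∸-monoˡ-< {n = 1} (n<1+n _) (≤-trans (s≤s z≤n) (proj₁ (label-range V e))))
                                            (proj₂ (label-range V e))))
        from : BranchLabel L 2 → BranchLabel (∂K P m L) m
        from bl with empty-if-2 onBranch-slid bl
        ... | y , y∈C , e = y , y∈C , trans ∂K-branch (cong (finish m) e)

    m-1 : ℕ
    m-1 = suc m-2

    branchLabel-resp-≗ : ∀ {L L'} → L ≗ L' → ∀ {v} → BranchLabel L v → BranchLabel L' v
    branchLabel-resp-≗ L≗L' (y , y∈C , Ly≡v) = y , y∈C , trans (sym (L≗L' y)) Ly≡v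

    Residue : Labeling n → Pred ℕ 0ℓ
    Residue L r = BranchLabel L (2 + r % m-1)

    residue? : ∀ L → Decidable (Residue L)
    residue? L r = branchLabel? L (2 + r % m-1)

    residue-periodic : ∀ L → Periodic (Residue L) m-1
    residue-periodic L r = subst (λ u → Residue L r ⇔ BranchLabel L (2 + u)) (sym ([m+n]%n≡m%n r m-1)) ⇔.refl

    [r+1]%m-1 : ∀ r → (r + 1) % m-1 ≡ suc (r % m-1) % m-1
    [r+1]%m-1 r = begin
        (r + 1) % m-1                          ≡⟨ cong (λ u → (u + 1) % m-1) (m≡m%n+[m/n]*n r m-1) ⟩
        (r % m-1 + r / m-1 * m-1 + 1) % m-1    ≡⟨ cong (_% m-1) (+-comm (r % m-1 + _) 1) ⟩
        (suc (r % m-1) + r / m-1 * m-1) % m-1  ≡⟨ [m+kn]%n≡m%n (suc (r % m-1)) (r / m-1) m-1 ⟩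
        suc (r % m-1) % m-1                    ∎
      where open ≡-Reasoning

    [r+1]%m-1-cases : ∀ r → suc (r % m-1) < m-1 × (r + 1) % m-1 ≡ suc (r % m-1) ⊎ r % m-1 ≡ m-2 × (r + 1) % m-1 ≡ 0
    [r+1]%m-1-cases r with suc (r % m-1) <? m-1
    ... | yes <m-1 = inj₁ (<m-1 , trans ([r+1]%m-1 r) (m<n⇒m%n≡m <m-1))
    ... | no ≮m-1 = inj₂ (r%m-1≡m-2 , trans ([r+1]%m-1 r) (trans (cong (λ u → suc u % m-1) r%m-1≡m-2) (n%n≡0 m-1)))
      where
      r%m-1≡m-2 : r % m-1 ≡ m-2
      r%m-1≡m-2 = suc-injective (≤-antisym (m%n<n r m-1) (≮⇒≥ ≮m-1))

    ∂K-residue : ∀ {L} → Packed L → ∀ r → Residue (∂K P m L) r ⇔ Residue L (r + 1)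
    ∂K-residue {L} pk r with [r+1]%m-1-cases r
    ... | inj₁ (<m-1 , e) = subst (λ u → Residue (∂K P m L) r ⇔ BranchLabel L (2 + u)) (sym e)
                              (∂K-branch-label pk (m≤m+n 2 _) (s≤s (s≤s (s≤s⁻¹ <m-1))))
    ... | inj₂ (r%m-1≡m-2 , e) = subst₂ (λ u w → BranchLabel (∂K P m L) (2 + u) ⇔ BranchLabel L (2 + w)) (sym r%m-1≡m-2) (sym e)
                                   (∂K-branch-label-m pk)

    iterate-residue : ∀ {L} → Packed L → ∀ s r → Residue (iterate (∂K P m) s L) r ⇔ Residue L (r + s)
    iterate-residue {L} pk zero r = subst (λ u → Residue L r ⇔ Residue L u) (sym (+-identityʳ r)) ⇔.refl
    iterate-residue {L} pk (suc s) r =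
      ⇔.trans (∂K-residue (iterate-packed (s≤s z≤n) s pk) r)
        (subst (λ u → Residue (iterate (∂K P m) s L) (r + 1) ⇔ Residue L u) (+-assoc r 1 s)
               (iterate-residue pk s (r + 1)))

    fixed⇒residue-periodic : ∀ {L s} → Packed L → iterate (∂K P m) s L ≗ L → Periodic (Residue L) s
    fixed⇒residue-periodic {L} {s} pk fixed r =
      ⇔.trans (mk⇔ (branchLabel-resp-≗ (λ x → sym (fixed x))) (branchLabel-resp-≗ fixed)) (iterate-residue pk s r)

    module _ {L : Labeling n} (pk : Packed L) where
      private
        injective : ∀ {x y} → x ∈ C → y ∈ C → L x ≡ L y → x ≡ y
        injective = strict-injective-on-branch (proj₂ (proj₂ pk))
        2≤L : ∀ {y} → y ∈ C → 2 ≤ L y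
        2≤L y∈C = L-≥2 pk (branch-≢z y∈C)

      count-branchLabel : count (branchLabel? L) (suc m) ≡ Data.List.length C
      count-branchLabel = count-image L (suc m) C branch-unique injective (λ {y} _ → s≤s (proj₂ (proj₁ pk y)))

      count-residue : count (residue? L) m-1 ≡ Data.List.length C
      count-residue = trans (count-cong (residue? L) (image? (λ y → L y ∸ 2) C) m-1 (λ r r<m-1 → mk⇔ (to r<m-1) (from r<m-1)))
        (count-image (λ y → L y ∸ 2) m-1 C branch-unique
          (λ x∈C y∈C e → injective x∈C y∈C (∸-cancelʳ-≡ (2≤L x∈C) (2≤L y∈C) e))
          (λ {y} y∈C → ∸-monoˡ-< {n = 2} (s≤s (proj₂ (proj₁ pk y))) (2≤L y∈C)))
        where
        to : ∀ {r} → r < m-1 → Residue L r → Image (λ y → L y ∸ 2) C r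
        to {r} r<m-1 (y , y∈C , e) = y , y∈C , trans (cong (_∸ 2) e) (m<n⇒m%n≡m r<m-1)
        from : ∀ {r} → r < m-1 → Image (λ y → L y ∸ 2) C r → Residue L r
        from {r} r<m-1 (y , y∈C , e) =
          y , y∈C , trans (sym (m+[n∸m]≡n (2≤L y∈C))) (cong (2 +_) (trans e (sym (m<n⇒m%n≡m r<m-1))))

-- Compress the labels off the branch to 2, 3, … and put the branch on the top k labels.
module TopLabeling {n} (P : FinPoset n) {z : Fin n} {C : List (Fin n)} (z-min : IsMinimum P z) (branch : IsBranch P z C)
                   (m-2 : ℕ) {L₀ : Labeling n} (pk₀ : IsPacked P (suc (suc m-2)) L₀)
                   {k : ℕ} (|C|≡k : length C ≡ k) (k<m-1 : k < suc m-2) where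
  open PosetFacts P
  open Branch P z-min branch
  open Rotation m-2
  open Promotion P m
  open DecMembership (Data.Fin._≟_ {n}) using (_∈?_)

  private
    bounds₀ : ∀ x → 1 ≤ L₀ x × L₀ x ≤ m
    bounds₀ = proj₁ pk₀
    onto₀ : ∀ j → 1 ≤ j → j ≤ m → ∃ λ x → L₀ x ≡ j
    onto₀ = proj₁ (proj₂ pk₀)
    strict₀ : ∀ x y → x ≺ y → L₀ x < L₀ y
    strict₀ = proj₂ (proj₂ pk₀)

  Off : Fin n → Set
  Off x = x ≢ z × x ∉ C

  OffLabel : Pred ℕ 0ℓ
  OffLabel w = ∃ λ q → Off q × L₀ q ≡ w

  offLabel? : Decidable OffLabel
  offLabel? w = any? (λ q → (¬? (q Data.Fin.≟ z) ×-dec ¬? (q ∈? C)) ×-dec (L₀ q ≟ w))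

  rankOff rankOn : ℕ → ℕ
  rankOff = count offLabel?
  rankOn = count (branchLabel? L₀)

  label : ∀ x → Dec (x ≡ z) → Dec (x ∈ C) → ℕ
  label x (yes _) _ = 1
  label x (no _) (yes _) = 2 + (m-1 ∸ k + rankOn (L₀ x))
  label x (no _) (no _) = 2 + rankOff (L₀ x)

  L⋆ : Labeling n
  L⋆ x = label x (x Data.Fin.≟ z) (x ∈? C)

  data Position (x : Fin n) (v : ℕ) : Set where
    minimum : x ≡ z → v ≡ 1 → Position x v
    on      : x ∈ C → v ≡ 2 + (m-1 ∸ k + rankOn (L₀ x)) → Position x v
    off     : Off x → v ≡ 2 + rankOff (L₀ x) → Position x v

  position : ∀ x → Position x (L⋆ x)
  position x = classify (x Data.Fin.≟ z) (x ∈? C)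
    where
    classify : ∀ d e → Position x (label x d e)
    classify (yes x≡z) _ = minimum x≡z refl
    classify (no _) (yes x∈C) = on x∈C refl
    classify (no x≢z) (no x∉C) = off (x≢z , x∉C) refl

  private
    count-branchLabel₀ : count (branchLabel? L₀) (suc m) ≡ k
    count-branchLabel₀ = trans (count-branchLabel pk₀) |C|≡k

    L₀<1+m : ∀ x → L₀ x < suc m
    L₀<1+m x = s≤s (proj₂ (bounds₀ x))

    rankOn<k : ∀ {y} → y ∈ C → rankOn (L₀ y) < k
    rankOn<k {y} y∈C = subst (rankOn (L₀ y) <_) count-branchLabel₀ (count-< (branchLabel? L₀) (L₀<1+m y) (y , y∈C , refl))

    on-label-< : ∀ {y} → y ∈ C → m-1 ∸ k + rankOn (L₀ y) < m-1
    on-label-< {y} y∈C = begin-strict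
        m-1 ∸ k + rankOn (L₀ y)   <⟨ +-monoʳ-< (m-1 ∸ k) (rankOn<k y∈C) ⟩
        m-1 ∸ k + k               ≡⟨ m∸n+n≡m (<⇒≤ k<m-1) ⟩
        m-1                       ∎
      where open ≤-Reasoning

    off-label-≤ : ∀ {q} → Off q → rankOff (L₀ q) ≤ m-2
    off-label-≤ {q} (q≢z , _) = begin
        rankOff (L₀ q)   ≤⟨ count-≤-∸ offLabel? (λ { w (q' , (q'≢z , _) , refl) → L-≥2 pk₀ q'≢z }) (L₀ q) ⟩
        L₀ q ∸ 2         ≤⟨ ∸-monoˡ-≤ 2 (proj₂ (bounds₀ q)) ⟩
        m ∸ 2            ∎
      where open ≤-Reasoning

    -- Every label in 2, …, m is used by L₀ on the branch or off it.
    many-off-labels : m-1 ∸ k ≤ rankOff (suc m)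
    many-off-labels = m≤n+o⇒m∸n≤o m-1 k (begin
        m-1                                                            ≡⟨ count-≥ 2 (suc m) ⟨
        count (2 ≤?_) (suc m)                                          ≤⟨ count-mono (2 ≤?_) (λ w → offLabel? w ⊎-dec branchLabel? L₀ w) (suc m) used ⟩
        count (λ w → offLabel? w ⊎-dec branchLabel? L₀ w) (suc m)      ≤⟨ count-⊎-≤ offLabel? (branchLabel? L₀) (suc m) ⟩
        rankOff (suc m) + count (branchLabel? L₀) (suc m)              ≡⟨ cong (rankOff (suc m) +_) count-branchLabel₀ ⟩
        rankOff (suc m) + k                                            ≡⟨ +-comm _ k ⟩
        k + rankOff (suc m)                                            ∎)
      where
      open ≤-Reasoning
      used : ∀ w → w < suc m → 2 ≤ w → OffLabel w ⊎ BranchLabel L₀ w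
      used w w<1+m 2≤w with onto₀ w (≤-trans (s≤s z≤n) 2≤w) (s≤s⁻¹ w<1+m)
      ... | x , L₀x≡w with x Data.Fin.≟ z | x ∈? C
      ...   | yes refl | _ = ⊥-elim (<-irrefl (trans (sym (L-min pk₀)) L₀x≡w) 2≤w)
      ...   | no _ | yes x∈C = inj₂ (x , x∈C , L₀x≡w)
      ...   | no x≢z | no x∉C = inj₁ (x , (x≢z , x∉C) , L₀x≡w)

  private
    top-rank< : ∀ {r} → m-1 ∸ k ≤ r → r < m-1 → r ∸ (m-1 ∸ k) < count (branchLabel? L₀) (suc m)
    top-rank< {r} top≤r r<m-1 = subst (r ∸ (m-1 ∸ k) <_) (sym count-branchLabel₀) (begin-strict
        r ∸ (m-1 ∸ k)      <⟨ ∸-monoˡ-< r<m-1 top≤r ⟩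
        m-1 ∸ (m-1 ∸ k)    ≡⟨ m∸[m∸n]≡n (<⇒≤ k<m-1) ⟩
        k                  ∎)
      where open ≤-Reasoning

  top-label : ∀ {r} → m-1 ∸ k ≤ r → r < m-1 → BranchLabel L⋆ (2 + r)
  top-label {r} top≤r r<m-1 with count-witness (branchLabel? L₀) (suc m) (r ∸ (m-1 ∸ k)) (top-rank< top≤r r<m-1)
  ... | _ , _ , (y , y∈C , refl) , rank≡ with position y
  ...   | minimum refl _ = ⊥-elim (branch-≢z y∈C refl)
  ...   | off (_ , y∉C) _ = ⊥-elim (y∉C y∈C)
  ...   | on _ L⋆y≡ = y , y∈C , trans L⋆y≡ (cong (2 +_) (trans (cong (m-1 ∸ k +_) rank≡) (m+[n∸m]≡n top≤r)))

  top-label⁻¹ : ∀ {r} → BranchLabel L⋆ (2 + r) → m-1 ∸ k ≤ r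
  top-label⁻¹ {r} (y , y∈C , L⋆y≡2+r) with position y
  ... | minimum refl _ = ⊥-elim (branch-≢z y∈C refl)
  ... | off (_ , y∉C) _ = ⊥-elim (y∉C y∈C)
  ... | on _ L⋆y≡ = subst (m-1 ∸ k ≤_) (suc-injective (suc-injective (trans (sym L⋆y≡) L⋆y≡2+r))) (m≤m+n _ _)

  top-residues : ∀ r → r < m-1 → Residue L⋆ r ⇔ m-1 ∸ k ≤ r
  top-residues r r<m-1 rewrite m<n⇒m%n≡m r<m-1 = mk⇔ top-label⁻¹ (λ top≤r → top-label top≤r r<m-1)

  L⋆-bounded : ∀ x → 1 ≤ L⋆ x × L⋆ x ≤ m
  L⋆-bounded x with position x
  ... | minimum _ e = ≤-reflexive (sym e) , subst (_≤ m) (sym e) (s≤s z≤n)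
  ... | on x∈C e = subst (1 ≤_) (sym e) (s≤s z≤n) , subst (_≤ m) (sym e) (+-monoʳ-≤ 2 (s≤s⁻¹ (on-label-< x∈C)))
  ... | off x-off e = subst (1 ≤_) (sym e) (s≤s z≤n) , subst (_≤ m) (sym e) (+-monoʳ-≤ 2 (off-label-≤ x-off))

  L⋆-onto : ∀ j → 1 ≤ j → j ≤ m → ∃ λ x → L⋆ x ≡ j
  L⋆-onto (suc zero) _ _ = z , L⋆-z
    where
    L⋆-z : L⋆ z ≡ 1
    L⋆-z with position z
    ... | minimum _ e = e
    ... | on z∈C _ = ⊥-elim (branch-≢z z∈C refl)
    ... | off (z≢z , _) _ = ⊥-elim (z≢z refl)
  L⋆-onto (suc (suc j)) _ j+2≤m with j <? m-1 ∸ k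
  ... | no j≮top = let y , y∈C , e = top-label (≮⇒≥ j≮top) (s≤s⁻¹ j+2≤m) in y , e
  ... | yes j<top with count-witness offLabel? (suc m) j (<-≤-trans j<top many-off-labels)
  ...   | _ , _ , (q , q-off , refl) , rank≡j with position q
  ...     | minimum q≡z _ = ⊥-elim (proj₁ q-off q≡z)
  ...     | on q∈C _ = ⊥-elim (proj₂ q-off q∈C)
  ...     | off _ e = q , trans e (cong (2 +_) rank≡j)

  L⋆-strict : ∀ x y → x ≺ y → L⋆ x < L⋆ y
  L⋆-strict x y x≺y with position x | position y
  ... | _ | minimum refl _ = ⊥-elim (≺-irrefl refl (≺-≼-trans x≺y (z-min x)))
  ... | minimum _ ex | on _ ey = subst₂ _<_ (sym ex) (sym ey) (s≤s (s≤s z≤n))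
  ... | minimum _ ex | off _ ey = subst₂ _<_ (sym ex) (sym ey) (s≤s (s≤s z≤n))
  ... | on x∈C ex | on y∈C ey = subst₂ _<_ (sym ex) (sym ey)
          (+-monoʳ-< 2 (+-monoʳ-< (m-1 ∸ k) (count-< (branchLabel? L₀) (strict₀ x y x≺y) (x , x∈C , refl))))
  ... | off x-off ex | off y-off ey = subst₂ _<_ (sym ex) (sym ey)
          (+-monoʳ-< 2 (count-< offLabel? (strict₀ x y x≺y) (x , x-off , refl)))
  ... | on x∈C _ | off (_ , y∉C) _ = ⊥-elim (y∉C (branch-up-closed x∈C x≺y))
  ... | off (x≢z , x∉C) _ | on y∈C _ = ⊥-elim (x∉C (branch-down-closed x≢z y∈C x≺y))

  L⋆-packed : Packed L⋆
  L⋆-packed = L⋆-bounded , L⋆-onto , L⋆-strict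

theorem2p4 : ∀ {n} (P : FinPoset n) (z : Fin n) (m k : ℕ) →
    IsMinimum P z →
    (∃ λ L → IsPacked P m L) →
    (∃ λ (C : List (Fin n)) → IsBranch P z C × length C ≡ k) →
    1 ≤ k → k + 2 ≤ m →
    (∃ λ t → IsOrderOfPromotion P m t × (m ∸ 1) ∣ t) ×
    (gcd k (m ∸ 1) ≡ 1 →
      ∀ L → IsPacked P m L → ∃ λ t → IsOrbitSize P m L t × (m ∸ 1) ∣ t)
theorem2p4 P z m k z-min (L₀ , pk₀) (C , branch , |C|≡k) 1≤k k+2≤m
  with m≤n⇒∃[o]m+o≡n (m+n≤o⇒n≤o k k+2≤m)
... | m-2 , refl = order-divisible , orbit-divisible
  where
  open Branch P z-min branch
  open Rotation m-2 hiding (m)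
  open PromotionDynamics P m-1
  k<m-1 : k < m-1
  k<m-1 = s≤s⁻¹ (subst (_≤ 2 + m-2) (+-comm k 2) k+2≤m)

  open TopLabeling P z-min branch m-2 pk₀ |C|≡k k<m-1

  order-divisible : ∃ λ t → IsOrderOfPromotion P m t × m-1 ∣ t
  order-divisible = let t , is-order@(_ , fixes-all , _) = order in t , is-order ,
    interval-invariant⇒∣ 1≤k k<m-1 top-residues (residue-periodic L⋆) (fixed⇒residue-periodic L⋆-packed (fixes-all L⋆ L⋆-packed))

  orbit-divisible : gcd k m-1 ≡ 1 → ∀ L → IsPacked P m L → ∃ λ t → IsOrbitSize P m L t × m-1 ∣ t
  orbit-divisible coprime L pk = let t , is-orbit@(_ , fixes-L , _) = orbitSize pk in t , is-orbit ,
    coprime-count-invariant⇒∣ (residue? L) (trans (count-residue pk) |C|≡k) coprime (residue-periodic L) (fixed⇒residue-periodic pk fixes-L)
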